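{- Define words over $\{0,1,2\}$ by $w_1=01$ and $w_i=w_{i-1}^2\big(\prod_{j=1}^{i-2}w_{i-1-j}\big)2$ for $i\ge2$, and let $w=\lim_{i\to\infty}w_i$. Let $\varphi:\{0,1\}^*\to\{0,1\}^*$ be the morphism with $\varphi(0)=001$, $\varphi(1)=01$, and let $\psi:\{0,1\}^*\to\{0,1,2\}^*$ be the morphism with $\psi(0)=01$, $\psi(1)=2$. Then $w=\psi(\varphi^\omega(0))$.
   Context: Products denote concatenation. A morphism is a map $\mu$ on words with $\mu(uv)=\mu(u)\mu(v)$, extended letterwise to infinite words; $\varphi^\omega(0)=\lim_{m\to\infty}\varphi^m(0)$ (each $\varphi^m(0)$ is a prefix of $\varphi^{m+1}(0)$). -}

module Defs where

open import Data.Nat using (ℕ; zero; suc; _≥_)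
open import Data.Fin using (Fin; zero; suc)
open import Data.List using (List; []; _∷_; _++_; concat; concatMap)
open import Data.Maybe using (Maybe; just; nothing)
open import Data.Product using (_×_; _,_; proj₁; ∃)
open import Relation.Binary.PropositionalEquality using (_≡_)

Word : Set → Set
Word A = List A

InfWord : Set → Set
InfWord A = ℕ → A

_!_ : {A : Set} → List A → ℕ → Maybe A
[] ! _ = nothing
(a ∷ u) ! zero = just a
(a ∷ u) ! suc n = u ! n

prefix : {A : Set} → ℕ → InfWord A → Word A
prefix zero x = []
prefix (suc n) x = x 0 ∷ prefix n (λ k → x (suc k))

IsLimit : {A : Set} → (ℕ → Word A) → InfWord A → Set
IsLimit {A} u x = ∀ n → ∃ λ i₀ → ∀ i → i ≥ i₀ → u i ! n ≡ just (x n)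

applyMorph : {A B : Set} → (A → Word B) → Word A → Word B
applyMorph f u = concatMap f u

iter : {A : Set} → (A → A) → ℕ → A → A
iter f zero a = a
iter f (suc m) a = f (iter f m a)

φ : Fin 2 → Word (Fin 2)
φ zero = zero ∷ zero ∷ suc zero ∷ []
φ (suc zero) = zero ∷ suc zero ∷ []

ψ : Fin 2 → Word (Fin 3)
ψ zero = zero ∷ suc zero ∷ []
ψ (suc zero) = suc (suc zero) ∷ []

φiter : ℕ → Word (Fin 2)
φiter m = iter (applyMorph φ) m (zero ∷ [])

-- wAux n = (w_{n+1} , w_n w_{n-1} ... w_1 as a list [w_n, ..., w_1])
wAux : ℕ → Word (Fin 3) × List (Word (Fin 3))
wAux zero = (zero ∷ suc zero ∷ []) , []
wAux (suc n) with wAux n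
... | u , prev = (u ++ u ++ concat prev ++ (suc (suc zero) ∷ [])) , (u ∷ prev)

-- wSeq n = w_{n+1}  (so wSeq 0 = w_1 = 01, and
--   w_i = w_{i-1}^2 (w_{i-2} w_{i-3} ... w_1) 2 for i ≥ 2)
wSeq : ℕ → Word (Fin 3)
wSeq n = proj₁ (wAux n)

-- Put A m = φ^m(0) and B m = φ^m(1). Since φ(0) = 0 0 1 and φ(1) = 0 1 we get
-- A (m+1) = A m · A m · B m and B (m+1) = A m · B m. Unfolding the recursion for w
-- shows w_{m+1} = ψ(A m) together with w_m w_{m-1} ⋯ w_1 2 = ψ(B m), so (w_i) and
-- (φ^i(0)) are prefix chains related letterwise by ψ, and both limits exist and match.
module Submission where

open import Defs
open import Data.Fin using (Fin; zero; suc)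
open import Data.List using (List; []; _∷_; _++_; concat; map; length)
open import Data.List.Properties using (++-assoc; ++-identityʳ; map-++; concat-++; length-++)
open import Data.Maybe using (just)
open import Data.Nat using (ℕ; zero; suc; _+_; _≤_; _<_; _≤′_; ≤′-refl; ≤′-step; z≤n; s≤s)
open import Data.Nat.Properties using (≤-trans; ≤-reflexive; <⇒≤; ≤⇒≤′; m≤m+n; +-mono-≤)
open import Data.Product using (_×_; ∃; _,_; proj₁; proj₂)
open import Relation.Binary.PropositionalEquality using (_≡_; refl; sym; trans; cong; subst; module ≡-Reasoning)

module _ {A : Set} where

  infix 4 _≼_
  _≼_ : List A → List A → Set
  u ≼ v = ∃ λ r → v ≡ u ++ r

  ≼-refl : (u : List A) → u ≼ u
  ≼-refl u = [] , sym (++-identityʳ u)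

  ≼-trans : {u v w : List A} → u ≼ v → v ≼ w → u ≼ w
  ≼-trans {u} (r , refl) (r′ , refl) = r ++ r′ , ++-assoc u r r′

  ++-!ˡ : (u r : List A) (n : ℕ) → n < length u → (u ++ r) ! n ≡ u ! n
  ++-!ˡ (a ∷ u) r zero    _       = refl
  ++-!ˡ (a ∷ u) r (suc n) (s≤s p) = ++-!ˡ u r n p

  ≼⇒!-agree : {u v : List A} (n : ℕ) → u ≼ v → n < length u → v ! n ≡ u ! n
  ≼⇒!-agree {u} n (r , refl) = ++-!ˡ u r n

  !-defined : (u : List A) (n : ℕ) → n < length u → ∃ λ a → u ! n ≡ just a
  !-defined (a ∷ u) zero    _       = a , refl
  !-defined (a ∷ u) (suc n) (s≤s p) = !-defined u n p

  !-agree⇒≼ : (u v : List A) → length u ≤ length v →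
              (∀ n → n < length u → u ! n ≡ v ! n) → u ≼ v
  !-agree⇒≼ []      v       _       _     = v , refl
  !-agree⇒≼ (a ∷ u) (b ∷ v) (s≤s l) agree with agree zero (s≤s z≤n)
  ... | refl with !-agree⇒≼ u v l (λ n p → agree (suc n) (s≤s p))
  ...   | r , v≡u++r = r , cong (a ∷_) v≡u++r

  length-prefix : (i : ℕ) (x : InfWord A) → length (prefix i x) ≡ i
  length-prefix zero    x = refl
  length-prefix (suc i) x = cong suc (length-prefix i (λ k → x (suc k)))

  prefix-! : (i : ℕ) (x : InfWord A) (n : ℕ) → n < i → prefix i x ! n ≡ just (x n)
  prefix-! (suc i) x zero    _       = refl
  prefix-! (suc i) x (suc n) (s≤s p) = prefix-! i (λ k → x (suc k)) n p

module PrefixChain {A : Set} (s : ℕ → List A)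
                   (s-≼-suc : ∀ i → s i ≼ s (suc i))
                   (s-long : ∀ i → i < length (s i)) where

  s-≼ : ∀ {i j} → i ≤′ j → s i ≼ s j
  s-≼ ≤′-refl      = ≼-refl _
  s-≼ (≤′-step i≤j) = ≼-trans (s-≼ i≤j) (s-≼-suc _)

  lim : InfWord A
  lim n = proj₁ (!-defined (s n) n (s-long n))

  s-! : ∀ {n i} → n ≤ i → s i ! n ≡ just (lim n)
  s-! {n} n≤i = trans (≼⇒!-agree n (s-≼ (≤⇒≤′ n≤i)) (s-long n))
                      (proj₂ (!-defined (s n) n (s-long n)))

  isLimit-≼ : (u : ℕ → List A) → (∀ i → u i ≼ s i) → (∀ i → i ≤ length (u i)) →
              IsLimit u lim
  isLimit-≼ u u≼s u-long n = suc n , λ i n<i →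
    trans (sym (≼⇒!-agree n (u≼s i) (≤-trans n<i (u-long i)))) (s-! (<⇒≤ n<i))

  isLimit : IsLimit s lim
  isLimit = isLimit-≼ s (λ i → ≼-refl (s i)) (λ i → <⇒≤ (s-long i))

  prefix-lim-≼ : ∀ i → prefix i lim ≼ s i
  prefix-lim-≼ i = !-agree⇒≼ (prefix i lim) (s i)
    (≤-trans (≤-reflexive (length-prefix i lim)) (<⇒≤ (s-long i)))
    (λ n p → let n<i = subst (n <_) (length-prefix i lim) p in
       trans (prefix-! i lim n n<i) (sym (s-! (<⇒≤ n<i))))

module _ {A B : Set} (f : A → Word B) where

  applyMorph-++ : (u v : Word A) → applyMorph f (u ++ v) ≡ applyMorph f u ++ applyMorph f v
  applyMorph-++ u v = trans (cong concat (map-++ f u v)) (sym (concat-++ (map f u) (map f v)))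

  applyMorph-≼ : {u v : Word A} → u ≼ v → applyMorph f u ≼ applyMorph f v
  applyMorph-≼ {u} (r , refl) = applyMorph f r , applyMorph-++ u r

  length-applyMorph : (∀ a → 1 ≤ length (f a)) → ∀ u → length u ≤ length (applyMorph f u)
  length-applyMorph nonErasing []      = z≤n
  length-applyMorph nonErasing (a ∷ u) =
    ≤-trans (+-mono-≤ (nonErasing a) (length-applyMorph nonErasing u))
            (≤-reflexive (sym (length-++ (f a))))

iter-suc : {X : Set} (f : X → X) (m : ℕ) (a : X) → iter f (suc m) a ≡ iter f m (f a)
iter-suc f zero    a = refl
iter-suc f (suc m) a = cong f (iter-suc f m a)

iter-++ : {A : Set} (F : List A → List A) → (∀ u v → F (u ++ v) ≡ F u ++ F v) →
          ∀ m u v → iter F m (u ++ v) ≡ iter F m u ++ iter F m v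
iter-++ F F-++ zero    u v = refl
iter-++ F F-++ (suc m) u v = trans (cong F (iter-++ F F-++ m u v)) (F-++ (iter F m u) _)

Φ : Word (Fin 2) → Word (Fin 2)
Φ = applyMorph φ

Ψ : Word (Fin 2) → Word (Fin 3)
Ψ = applyMorph ψ

φiter₁ : ℕ → Word (Fin 2)
φiter₁ m = iter Φ m (suc zero ∷ [])

Φ^-++ : ∀ m u v → iter Φ m (u ++ v) ≡ iter Φ m u ++ iter Φ m v
Φ^-++ = iter-++ Φ (applyMorph-++ φ)

φiter-suc : ∀ m → φiter (suc m) ≡ φiter m ++ φiter m ++ φiter₁ m
φiter-suc m = begin
  iter Φ (suc m) (zero ∷ [])                   ≡⟨ iter-suc Φ m (zero ∷ []) ⟩
  iter Φ m (zero ∷ zero ∷ suc zero ∷ [])       ≡⟨ Φ^-++ m (zero ∷ []) (zero ∷ suc zero ∷ []) ⟩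
  φiter m ++ iter Φ m (zero ∷ suc zero ∷ [])   ≡⟨ cong (φiter m ++_) (Φ^-++ m (zero ∷ []) (suc zero ∷ [])) ⟩
  φiter m ++ φiter m ++ φiter₁ m               ∎
  where open ≡-Reasoning

φiter₁-suc : ∀ m → φiter₁ (suc m) ≡ φiter m ++ φiter₁ m
φiter₁-suc m = trans (iter-suc Φ m (suc zero ∷ [])) (Φ^-++ m (zero ∷ []) (suc zero ∷ []))

φiter-≼-suc : ∀ m → φiter m ≼ φiter (suc m)
φiter-≼-suc m = φiter m ++ φiter₁ m , φiter-suc m

φiter-long : ∀ m → m < length (φiter m)
φiter-long zero    = s≤s z≤n
φiter-long (suc m) = ≤-trans (+-mono-≤ (≤-trans (s≤s z≤n) ih) (≤-trans ih (m≤m+n _ _)))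
                             (≤-reflexive (sym length-φiter-suc))
  where
  ih : m < length (φiter m)
  ih = φiter-long m
  length-φiter-suc : length (φiter (suc m)) ≡ length (φiter m) + (length (φiter m) + length (φiter₁ m))
  length-φiter-suc = begin
    length (φiter (suc m))                              ≡⟨ cong length (φiter-suc m) ⟩
    length (φiter m ++ φiter m ++ φiter₁ m)             ≡⟨ length-++ (φiter m) ⟩
    length (φiter m) + length (φiter m ++ φiter₁ m)     ≡⟨ cong (length (φiter m) +_) (length-++ (φiter m)) ⟩
    length (φiter m) + (length (φiter m) + length (φiter₁ m)) ∎
    where open ≡-Reasoning

two : Fin 3
two = suc (suc zero)

wAux≡Ψφiter : ∀ m → proj₁ (wAux m) ≡ Ψ (φiter m)
                  × concat (proj₂ (wAux m)) ++ two ∷ [] ≡ Ψ (φiter₁ m)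
wAux≡Ψφiter zero = refl , refl
wAux≡Ψφiter (suc m) with wAux m | wAux≡Ψφiter m
... | .(Ψ (φiter m)) , ws | refl , ws2≡ =
  (begin
    Ψ (φiter m) ++ Ψ (φiter m) ++ concat ws ++ two ∷ []  ≡⟨ cong (λ t → Ψ (φiter m) ++ Ψ (φiter m) ++ t) ws2≡ ⟩
    Ψ (φiter m) ++ Ψ (φiter m) ++ Ψ (φiter₁ m)          ≡⟨ cong (Ψ (φiter m) ++_) (sym (Ψ-++ (φiter m) _)) ⟩
    Ψ (φiter m) ++ Ψ (φiter m ++ φiter₁ m)              ≡⟨ sym (Ψ-++ (φiter m) _) ⟩
    Ψ (φiter m ++ φiter m ++ φiter₁ m)                  ≡⟨ cong Ψ (sym (φiter-suc m)) ⟩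
    Ψ (φiter (suc m))                                   ∎)
  , (begin
    (Ψ (φiter m) ++ concat ws) ++ two ∷ []              ≡⟨ ++-assoc (Ψ (φiter m)) (concat ws) _ ⟩
    Ψ (φiter m) ++ concat ws ++ two ∷ []                ≡⟨ cong (Ψ (φiter m) ++_) ws2≡ ⟩
    Ψ (φiter m) ++ Ψ (φiter₁ m)                         ≡⟨ sym (Ψ-++ (φiter m) _) ⟩
    Ψ (φiter m ++ φiter₁ m)                             ≡⟨ cong Ψ (sym (φiter₁-suc m)) ⟩
    Ψ (φiter₁ (suc m))                                  ∎)
  where
  open ≡-Reasoning
  Ψ-++ : ∀ u v → Ψ (u ++ v) ≡ Ψ u ++ Ψ v
  Ψ-++ = applyMorph-++ ψ

wSeq≡Ψφiter : ∀ m → wSeq m ≡ Ψ (φiter m)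
wSeq≡Ψφiter m = proj₁ (wAux≡Ψφiter m)

wSeq-≼-suc : ∀ i → wSeq i ≼ wSeq (suc i)
wSeq-≼-suc i with wAux i
... | w , ws = w ++ concat ws ++ two ∷ [] , refl

length-Ψ : ∀ u → length u ≤ length (Ψ u)
length-Ψ = length-applyMorph ψ λ { zero → s≤s z≤n ; (suc zero) → s≤s z≤n }

wSeq-long : ∀ i → i < length (wSeq i)
wSeq-long i = subst (λ w → i < length w) (sym (wSeq≡Ψφiter i))
                    (≤-trans (φiter-long i) (length-Ψ (φiter i)))

proposition5p9 : ∃ λ (x : InfWord (Fin 2)) → ∃ λ (y : InfWord (Fin 3)) →
    IsLimit φiter x × IsLimit (λ n → applyMorph ψ (prefix n x)) y × IsLimit wSeq y
proposition5p9 =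
  X.lim , W.lim , X.isLimit , W.isLimit-≼ (λ n → Ψ (prefix n X.lim)) Ψprefix≼wSeq Ψprefix-long , W.isLimit
  where
  module X = PrefixChain φiter φiter-≼-suc φiter-long
  module W = PrefixChain wSeq wSeq-≼-suc wSeq-long

  Ψprefix≼wSeq : ∀ i → Ψ (prefix i X.lim) ≼ wSeq i
  Ψprefix≼wSeq i = subst (Ψ (prefix i X.lim) ≼_) (sym (wSeq≡Ψφiter i))
                         (applyMorph-≼ ψ (X.prefix-lim-≼ i))

  Ψprefix-long : ∀ i → i ≤ length (Ψ (prefix i X.lim))
  Ψprefix-long i = subst (_≤ length (Ψ (prefix i X.lim))) (length-prefix i X.lim)
                         (length-Ψ (prefix i X.lim))
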